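{- There exists a constant $K$ such that for every integer $n \geq 7$, \[\mathrm{sat}^*(n,C_4) \leq \frac{11}{6} n + K.\]
   Context: An edge-coloring of a graph $G$ is a function $c: E(G)\to\mathbb{N}$; it is proper if any two edges sharing a vertex receive distinct colors. A subgraph is rainbow if all its edges receive distinct colors. Given a fixed graph $F$, a graph $G$ is (properly) rainbow $F$-saturated if (1) there exists a proper edge-coloring of $G$ with no rainbow subgraph isomorphic to $F$, and (2) for every pair of non-adjacent vertices $x,y$ of $G$, every proper edge-coloring of $G+xy$ contains a rainbow subgraph isomorphic to $F$. The proper rainbow saturation number $\mathrm{sat}^*(n,F)$ is the minimum number of edges in an $n$-vertex rainbow $F$-saturated graph. $C_k$ denotes the cycle on $k$ vertices. -}

module Defs where

open import Data.Nat using (ℕ; zero; suc; _+_; _*_; _≤_; _<ᵇ_)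
open import Data.Bool using (Bool; true; false; _∨_; _∧_; if_then_else_)
open import Data.Fin using (Fin; toℕ; _≟_)
open import Data.List using (List; map; allFin)
open import Data.Nat.ListAction using (sum)
open import Data.Product using (_×_; Σ)
open import Relation.Nullary using (¬_; does)
open import Relation.Binary.PropositionalEquality using (_≡_; _≢_)

Graph : ℕ → Set
Graph n = Fin n → Fin n → Bool

IsSimple : ∀ {n} → Graph n → Set
IsSimple {n} G = (∀ (i j : Fin n) → G i j ≡ G j i) × (∀ (i : Fin n) → G i i ≡ false)

edgeCount : ∀ {n} → Graph n → ℕ
edgeCount {n} G =
  sum (map (λ i → sum (map (λ j → if (toℕ i <ᵇ toℕ j) ∧ G i j then 1 else 0)
                           (allFin n)))
           (allFin n))

-- An edge-colouring: colour c i j ∈ ℕ for each ordered pair, required to be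
-- symmetric on edges (so it is a function E(G) → ℕ); values on non-edges are irrelevant.
Coloring : ℕ → Set
Coloring n = Fin n → Fin n → ℕ

IsEdgeColoring : ∀ {n} → Graph n → Coloring n → Set
IsEdgeColoring G c = ∀ i j → G i j ≡ true → c i j ≡ c j i

IsProper : ∀ {n} → Graph n → Coloring n → Set
IsProper G c = IsEdgeColoring G c ×
  (∀ i j k → G i j ≡ true → G i k ≡ true → j ≢ k → c i j ≢ c i k)

HasRainbowC4 : ∀ {n} → Graph n → Coloring n → Set
HasRainbowC4 {n} G c = Σ (Fin n) λ a → Σ (Fin n) λ b → Σ (Fin n) λ d → Σ (Fin n) λ e →
  (a ≢ b × a ≢ d × a ≢ e × b ≢ d × b ≢ e × d ≢ e) ×
  (G a b ≡ true × G b d ≡ true × G d e ≡ true × G e a ≡ true) ×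
  (c a b ≢ c b d × c a b ≢ c d e × c a b ≢ c e a ×
   c b d ≢ c d e × c b d ≢ c e a × c d e ≢ c e a)

addEdge : ∀ {n} → Graph n → Fin n → Fin n → Graph n
addEdge G x y i j =
  G i j ∨ ((does (i ≟ x) ∧ does (j ≟ y)) ∨ (does (i ≟ y) ∧ does (j ≟ x)))

IsRainbowC4Saturated : ∀ {n} → Graph n → Set
IsRainbowC4Saturated {n} G =
  (Σ (Coloring n) λ c → IsProper G c × ¬ HasRainbowC4 G c) ×
  (∀ (x y : Fin n) → x ≢ y → G x y ≡ false →
     ∀ (c : Coloring n) → IsProper (addEdge G x y) c → HasRainbowC4 (addEdge G x y) c)

-- sat*(n, C₄) ≤ m  ⇔  some n-vertex rainbow C₄-saturated simple graph has ≤ m edges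
-- (sat* is a minimum over such graphs).
SatStarC4≤ : ℕ → ℕ → Set
SatStarC4≤ n m = Σ (Graph n) λ G → IsSimple G × IsRainbowC4Saturated G × edgeCount G ≤ m

module Submission where

-- The graph is a hub joined to every vertex of a forest of spiders, each with three legs of which at
-- most one has length one. Naming colours by vertices (the hub edge at v gets v, a leg edge gets the
-- grandparent of its lower end, and the three edges at a centre are coloured by rotating its children)
-- gives a proper colouring without rainbow C₄. Conversely, let a proper colouring of G + xy have no
-- rainbow C₄. Then every 4-cycle through the hub repeats a colour on opposite edges; climbing the legs
-- this forces each forest edge to carry the colour of some hub edge, and the 4-cycles through the new
-- edge xy then produce two hub edges of equal colour. A spider has six vertices and five forest edges,
-- so G has about n + 5n/6 = 11n/6 edges.

open import Data.Bool using (true; false; _∧_; _∨_; if_then_else_; T)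
import Data.Bool as 𝔹
open import Data.Bool.Properties using (∨-zeroʳ; ∨-comm; ∧-comm)
open import Data.Empty using (⊥; ⊥-elim)
open import Data.Fin using (Fin; toℕ; _≟_; _↑ˡ_; _↑ʳ_; combine; remQuot; splitAt; fromℕ<)
  renaming (zero to fzero; suc to fsuc)
open import Data.Fin.Induction using (>-wellFounded)
open import Data.Fin.Properties
  using (toℕ-injective; toℕ<n; any?; toℕ-↑ˡ; toℕ-↑ʳ; toℕ-combine; toℕ-fromℕ<; splitAt-↑ˡ; splitAt-↑ʳ;
         splitAt⁻¹-↑ˡ; splitAt⁻¹-↑ʳ; remQuot-combine; combine-remQuot)
  renaming (suc-injective to fsuc-injective)
open import Data.List using (tabulate; map; allFin)
open import Data.List.Properties using (map-tabulate)
import Data.Nat as ℕ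
open import Data.Nat using (ℕ; zero; suc; _+_; _*_; _≤_; _<_; z≤n; s≤s; s≤s⁻¹; _<ᵇ_)
open import Data.Nat.DivMod using (_/_; _%_; m≡m%n+[m/n]*n; m%n<n; /-monoˡ-≤)
open import Data.Nat.ListAction using (sum)
open import Data.Nat.Properties hiding (_≟_)
open import Data.Nat.Tactic.RingSolver using (solve-∀)
open import Data.Product using (Σ; Σ-syntax; _×_; _,_; proj₁; proj₂)
open import Data.Sum using (_⊎_; inj₁; inj₂; [_,_]′)
import Data.Sum as Sum
open import Function using (_∘_; id)
open import Function.Bundles using (mk⇔)
open import Induction.WellFounded using (module All)
open import Level using (0ℓ)
open import Relation.Binary.PropositionalEquality
open import Relation.Nullary using (Dec; yes; no; does; ¬_; contradiction)
open import Relation.Nullary.Decidable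
  using (does-⇔; dec-false; dec-true; ¬?; _×-dec_; _⊎-dec_; toSum; decidable-stable)

open import Defs

-- Sums over Fin and edge counts

∑ : ∀ {n} → (Fin n → ℕ) → ℕ
∑ f = sum (tabulate f)

∑-cong : ∀ {n} {f g : Fin n → ℕ} → (∀ i → f i ≡ g i) → ∑ f ≡ ∑ g
∑-cong {zero} f≗g = refl
∑-cong {suc n} f≗g = cong₂ _+_ (f≗g fzero) (∑-cong (f≗g ∘ fsuc))

∑-mono-≤ : ∀ {n} {f g : Fin n → ℕ} → (∀ i → f i ≤ g i) → ∑ f ≤ ∑ g
∑-mono-≤ {zero} f≤g = z≤n
∑-mono-≤ {suc n} f≤g = +-mono-≤ (f≤g fzero) (∑-mono-≤ (f≤g ∘ fsuc))

∑-const : ∀ n c → ∑ {n} (λ _ → c) ≡ n * c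
∑-const zero c = refl
∑-const (suc n) c = cong (c +_) (∑-const n c)

∑-zero : ∀ {n} {f : Fin n → ℕ} → (∀ i → f i ≡ 0) → ∑ f ≡ 0
∑-zero {n} f≗0 = trans (∑-cong f≗0) (trans (∑-const n 0) (*-zeroʳ n))

∑-single : ∀ {n} {f : Fin n → ℕ} k → (∀ j → j ≢ k → f j ≡ 0) → ∑ f ≡ f k
∑-single {f = f} fzero vanish =
  trans (cong (f fzero +_) (∑-zero (λ j → vanish (fsuc j) λ ()))) (+-identityʳ _)
∑-single {f = f} (fsuc k) vanish =
  trans (cong (_+ ∑ (f ∘ fsuc)) (vanish fzero λ ()))
        (∑-single k (λ j j≢k → vanish (fsuc j) (j≢k ∘ fsuc-injective)))

∑-++ : ∀ m {k} (f : Fin (m + k) → ℕ) → ∑ f ≡ ∑ (f ∘ (_↑ˡ k)) + ∑ (f ∘ (m ↑ʳ_))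
∑-++ zero f = refl
∑-++ (suc m) f = trans (cong (f fzero +_) (∑-++ m (f ∘ fsuc))) (sym (+-assoc (f fzero) _ _))

∑-combine : ∀ m {k} (f : Fin (m * k) → ℕ) → ∑ f ≡ ∑ {m} (λ i → ∑ {k} (λ j → f (combine i j)))
∑-combine zero f = refl
∑-combine (suc m) {k} f =
  trans (∑-++ k f) (cong (∑ (λ j → f (j ↑ˡ (m * k))) +_) (∑-combine m (f ∘ (k ↑ʳ_))))

upEdge : ∀ {n} → Graph n → Fin n → Fin n → ℕ
upEdge G i j = if (toℕ i <ᵇ toℕ j) ∧ G i j then 1 else 0

upEdge≤1 : ∀ {n} (G : Graph n) i j → upEdge G i j ≤ 1
upEdge≤1 G i j with (toℕ i <ᵇ toℕ j) ∧ G i j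
... | true = ≤-refl
... | false = z≤n

upEdge-absent : ∀ {n} (G : Graph n) i j → (toℕ i < toℕ j → G i j ≢ true) → upEdge G i j ≡ 0
upEdge-absent G i j absent with toℕ i <ᵇ toℕ j in i<ᵇj | G i j
... | false | _ = refl
... | true | false = refl
... | true | true = ⊥-elim (absent (<ᵇ⇒< _ _ (subst T (sym i<ᵇj) _)) refl)

edgeCount≤∑ : ∀ {n} (G : Graph n) (w : Fin n → ℕ) → (∀ i → ∑ (upEdge G i) ≤ w i) → edgeCount G ≤ ∑ w
edgeCount≤∑ {n} G w rows≤w = begin
  edgeCount G                 ≡⟨ cong sum (map-tabulate id row) ⟩
  ∑ row                       ≡⟨ ∑-cong (λ i → cong sum (map-tabulate id (upEdge G i))) ⟩
  ∑ (λ i → ∑ (upEdge G i))    ≤⟨ ∑-mono-≤ rows≤w ⟩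
  ∑ w                         ∎
  where
    open ≤-Reasoning
    row : Fin n → ℕ
    row i = sum (map (upEdge G i) (allFin n))

-- Spider forests and the hub join

-- Parent pointers of a rooted forest on the non-hub vertices; roots are the fixed points.
record SpiderForest {V : Set} (rank : V → ℕ) (hub : V) (parent : V → V) : Set where
  IsRoot : V → Set
  IsRoot r = r ≢ hub × parent r ≡ r

  IsChildOf : V → V → Set
  IsChildOf a r = parent a ≡ r × a ≢ r

  IsLeaf : V → Set
  IsLeaf v = ∀ z → parent z ≡ v → z ≡ v

  field
    parent-hub : parent hub ≡ hub
    parent≢hub : ∀ {v} → v ≢ hub → parent v ≢ hub
    parent-increasing : ∀ {v} → parent v ≢ v → rank v < rank (parent v)
    child₁ child₂ child₃ : V → V
    child₁-isChild : ∀ {r} → IsRoot r → IsChildOf (child₁ r) r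
    child₂-isChild : ∀ {r} → IsRoot r → IsChildOf (child₂ r) r
    child₃-isChild : ∀ {r} → IsRoot r → IsChildOf (child₃ r) r
    child₁≢child₂ : ∀ {r} → IsRoot r → child₁ r ≢ child₂ r
    child₁≢child₃ : ∀ {r} → IsRoot r → child₁ r ≢ child₃ r
    child₂≢child₃ : ∀ {r} → IsRoot r → child₂ r ≢ child₃ r
    root-children : ∀ {r a} → IsRoot r → IsChildOf a r → a ≡ child₁ r ⊎ a ≡ child₂ r ⊎ a ≡ child₃ r
    nonroot-child-unique : ∀ {x a b} → parent x ≢ x → parent a ≡ x → parent b ≡ x → a ≡ b
    leaf-child-unique : ∀ {r a b} → IsRoot r → IsChildOf a r → IsChildOf b r → IsLeaf a → IsLeaf b → a ≡ b

does-true⇒ : ∀ {A : Set} (a? : Dec A) → does a? ≡ true → A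
does-true⇒ (yes a) _ = a
does-true⇒ (no _) ()

module HubJoin {n : ℕ} {hub : Fin n} {parent : Fin n → Fin n} (F : SpiderForest toℕ hub parent) where
  open SpiderForest F

  Edge : Fin n → Fin n → Set
  Edge u v = u ≢ v × (u ≡ hub ⊎ v ≡ hub ⊎ parent u ≡ v ⊎ parent v ≡ u)

  edge? : ∀ u v → Dec (Edge u v)
  edge? u v = ¬? (u ≟ v) ×-dec (u ≟ hub ⊎-dec v ≟ hub ⊎-dec parent u ≟ v ⊎-dec parent v ≟ u)

  G : Graph n
  G u v = does (edge? u v)

  G⇒Edge : ∀ {u v} → G u v ≡ true → Edge u v
  G⇒Edge {u} {v} = does-true⇒ (edge? u v)

  Edge⇒G : ∀ {u v} → Edge u v → G u v ≡ true
  Edge⇒G {u} {v} = dec-true (edge? u v)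

  Edge-sym : ∀ {u v} → Edge u v → Edge v u
  Edge-sym (u≢v , inj₁ u≡hub) = ≢-sym u≢v , inj₂ (inj₁ u≡hub)
  Edge-sym (u≢v , inj₂ (inj₁ v≡hub)) = ≢-sym u≢v , inj₁ v≡hub
  Edge-sym (u≢v , inj₂ (inj₂ (inj₁ pu≡v))) = ≢-sym u≢v , inj₂ (inj₂ (inj₂ pu≡v))
  Edge-sym (u≢v , inj₂ (inj₂ (inj₂ pv≡u))) = ≢-sym u≢v , inj₂ (inj₂ (inj₁ pv≡u))

  G-simple : IsSimple G
  G-simple = (λ u v → does-⇔ (mk⇔ Edge-sym Edge-sym) (edge? u v) (edge? v u))
           , (λ u → dec-false (edge? u u) (λ e → proj₁ e refl))

  hub-edge : ∀ {v} → v ≢ hub → G hub v ≡ true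
  hub-edge v≢hub = Edge⇒G (≢-sym v≢hub , inj₁ refl)

  parent-edge : ∀ {u v} → parent u ≡ v → u ≢ v → G u v ≡ true
  parent-edge pu≡v u≢v = Edge⇒G (u≢v , inj₂ (inj₂ (inj₁ pu≡v)))

  child<parent : ∀ {u v} → parent u ≡ v → u ≢ v → toℕ u < toℕ v
  child<parent {u} refl u≢pu = parent-increasing (u≢pu ∘ sym)

  parent-asym : ∀ {u v} → parent u ≡ v → parent v ≡ u → u ≢ v → ⊥
  parent-asym pu pv u≢v = <-asym (child<parent pu u≢v) (child<parent pv (≢-sym u≢v))

  forest-edge : ∀ {u v} → u ≢ hub → v ≢ hub → G u v ≡ true → parent u ≡ v ⊎ parent v ≡ u
  forest-edge u≢hub v≢hub g with G⇒Edge g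
  ... | _ , inj₁ u≡hub = ⊥-elim (u≢hub u≡hub)
  ... | _ , inj₂ (inj₁ v≡hub) = ⊥-elim (v≢hub v≡hub)
  ... | _ , inj₂ (inj₂ e) = e

  no-forest-4-cycle : ∀ {a b d e} → a ≢ b → a ≢ d → a ≢ e → b ≢ d → b ≢ e → d ≢ e →
                      parent a ≡ b ⊎ parent b ≡ a → parent b ≡ d ⊎ parent d ≡ b →
                      parent d ≡ e ⊎ parent e ≡ d → parent e ≡ a ⊎ parent a ≡ e → ⊥
  no-forest-4-cycle ab ad ae bd be de (inj₁ p₁) (inj₁ p₂) (inj₁ p₃) (inj₁ p₄) =
    <-asym (<-trans (child<parent p₁ ab) (<-trans (child<parent p₂ bd) (child<parent p₃ de)))
           (child<parent p₄ (≢-sym ae))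
  no-forest-4-cycle ab ad ae bd be de (inj₂ p₁) (inj₂ p₂) (inj₂ p₃) (inj₂ p₄) =
    <-asym (<-trans (child<parent p₄ ae) (<-trans (child<parent p₃ (≢-sym de)) (child<parent p₂ (≢-sym bd))))
           (child<parent p₁ (≢-sym ab))
  no-forest-4-cycle ab ad ae bd be de (inj₁ p₁) _ _ (inj₂ p₄) = be (trans (sym p₁) p₄)
  no-forest-4-cycle ab ad ae bd be de (inj₂ p₁) (inj₁ p₂) _ _ = ad (trans (sym p₁) p₂)
  no-forest-4-cycle ab ad ae bd be de _ (inj₂ p₂) (inj₁ p₃) _ = be (trans (sym p₂) p₃)
  no-forest-4-cycle ab ad ae bd be de _ _ (inj₂ p₃) (inj₁ p₄) = ad (sym (trans (sym p₃) p₄))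

  child≢hub : ∀ {a u} → parent a ≡ u → u ≢ hub → a ≢ hub
  child≢hub pa u≢hub refl = u≢hub (trans (sym pa) parent-hub)

  nonroot≢hub : ∀ {u} → parent u ≢ u → u ≢ hub
  nonroot≢hub pu≢u refl = pu≢u parent-hub

  child≢grandparent : ∀ {a x} → IsChildOf a x → parent x ≢ x → a ≢ parent x
  child≢grandparent (pa , a≢x) px≢x a≡px =
    <-irrefl (cong toℕ a≡px) (<-trans (child<parent pa a≢x) (parent-increasing px≢x))

  other-children : ∀ {r a} → IsRoot r → IsChildOf a r →
                   Σ[ b ∈ Fin n ] Σ[ d ∈ Fin n ] IsChildOf b r × IsChildOf d r × b ≢ a × d ≢ a × b ≢ d
  other-children root a-child with root-children root a-child
  ... | inj₁ refl = _ , _ , child₂-isChild root , child₃-isChild root ,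
                    ≢-sym (child₁≢child₂ root) , ≢-sym (child₁≢child₃ root) , child₂≢child₃ root
  ... | inj₂ (inj₁ refl) = _ , _ , child₁-isChild root , child₃-isChild root ,
                    child₁≢child₂ root , ≢-sym (child₂≢child₃ root) , child₁≢child₃ root
  ... | inj₂ (inj₂ refl) = _ , _ , child₁-isChild root , child₂-isChild root ,
                    child₁≢child₃ root , child₂≢child₃ root , child₁≢child₂ root

  third-child : ∀ {r a b} → IsRoot r → IsChildOf a r → Σ[ d ∈ Fin n ] IsChildOf d r × d ≢ a × d ≢ b
  third-child {b = b} root a-child with other-children root a-child
  ... | b′ , d′ , b′-child , d′-child , b′≢a , d′≢a , b′≢d′ with b′ ≟ b
  ...   | yes refl = d′ , d′-child , d′≢a , ≢-sym b′≢d′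
  ...   | no b′≢b = b′ , b′-child , b′≢a , b′≢b

  child-or-leaf : ∀ v → (Σ[ a ∈ Fin n ] IsChildOf a v) ⊎ IsLeaf v
  child-or-leaf v with any? (λ a → parent a ≟ v ×-dec ¬? (a ≟ v))
  ... | yes child = inj₁ child
  ... | no childless = inj₂ (λ z pz → decidable-stable (z ≟ v) (λ z≢v → childless (z , pz , z≢v)))

  rotate : Fin n → Fin n → Fin n
  rotate r a with a ≟ child₁ r | a ≟ child₂ r
  ... | yes _ | _ = child₂ r
  ... | no _ | yes _ = child₃ r
  ... | no _ | no _ = child₁ r

  module Rotation {r : Fin n} (root : IsRoot r) where
    rotate-child₁ : rotate r (child₁ r) ≡ child₂ r
    rotate-child₁ with child₁ r ≟ child₁ r
    ... | yes _ = refl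
    ... | no c₁≢c₁ = ⊥-elim (c₁≢c₁ refl)

    rotate-child₂ : rotate r (child₂ r) ≡ child₃ r
    rotate-child₂ with child₂ r ≟ child₁ r | child₂ r ≟ child₂ r
    ... | yes c₂≡c₁ | _ = ⊥-elim (child₁≢child₂ root (sym c₂≡c₁))
    ... | no _ | yes _ = refl
    ... | no _ | no c₂≢c₂ = ⊥-elim (c₂≢c₂ refl)

    rotate-child₃ : rotate r (child₃ r) ≡ child₁ r
    rotate-child₃ with child₃ r ≟ child₁ r | child₃ r ≟ child₂ r
    ... | yes c₃≡c₁ | _ = ⊥-elim (child₁≢child₃ root (sym c₃≡c₁))
    ... | no _ | yes c₃≡c₂ = ⊥-elim (child₂≢child₃ root (sym c₃≡c₂))
    ... | no _ | no _ = refl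

    rotate-isChild : ∀ a → IsChildOf (rotate r a) r
    rotate-isChild a with a ≟ child₁ r | a ≟ child₂ r
    ... | yes _ | _ = child₂-isChild root
    ... | no _ | yes _ = child₃-isChild root
    ... | no _ | no _ = child₁-isChild root

    rotate≢ : ∀ {a} → IsChildOf a r → rotate r a ≢ a
    rotate≢ a-child with root-children root a-child
    ... | inj₁ refl = child₁≢child₂ root ∘ sym ∘ trans (sym rotate-child₁)
    ... | inj₂ (inj₁ refl) = child₂≢child₃ root ∘ sym ∘ trans (sym rotate-child₂)
    ... | inj₂ (inj₂ refl) = child₁≢child₃ root ∘ trans (sym rotate-child₃)

    rotate-links : ∀ {a b} → IsChildOf a r → IsChildOf b r → a ≢ b → rotate r a ≡ b ⊎ rotate r b ≡ a
    rotate-links a-child b-child a≢b with root-children root a-child | root-children root b-child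
    ... | inj₁ refl | inj₁ refl = ⊥-elim (a≢b refl)
    ... | inj₁ refl | inj₂ (inj₁ refl) = inj₁ rotate-child₁
    ... | inj₁ refl | inj₂ (inj₂ refl) = inj₂ rotate-child₃
    ... | inj₂ (inj₁ refl) | inj₁ refl = inj₂ rotate-child₁
    ... | inj₂ (inj₁ refl) | inj₂ (inj₁ refl) = ⊥-elim (a≢b refl)
    ... | inj₂ (inj₁ refl) | inj₂ (inj₂ refl) = inj₁ rotate-child₂
    ... | inj₂ (inj₂ refl) | inj₁ refl = inj₁ rotate-child₃
    ... | inj₂ (inj₂ refl) | inj₂ (inj₁ refl) = inj₂ rotate-child₂
    ... | inj₂ (inj₂ refl) | inj₂ (inj₂ refl) = ⊥-elim (a≢b refl)

    rotate-injective : ∀ {a b} → IsChildOf a r → IsChildOf b r → rotate r a ≡ rotate r b → a ≡ b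
    rotate-injective {a} {b} a-child b-child ra≡rb = decidable-stable (a ≟ b) λ a≢b →
      [ (λ ra≡b → rotate≢ b-child (trans (sym ra≡rb) ra≡b)) , (λ rb≡a → rotate≢ a-child (trans ra≡rb rb≡a)) ]′
        (rotate-links a-child b-child a≢b)

  parentEdgeColour : Fin n → Fin n
  parentEdgeColour v with parent (parent v) ≟ parent v
  ... | yes _ = rotate (parent v) v
  ... | no _ = parent (parent v)

  parentEdgeColour-root : ∀ {v} → parent (parent v) ≡ parent v → parentEdgeColour v ≡ rotate (parent v) v
  parentEdgeColour-root {v} root with parent (parent v) ≟ parent v
  ... | yes _ = refl
  ... | no nonroot = ⊥-elim (nonroot root)

  parentEdgeColour-nonroot : ∀ {v} → parent (parent v) ≢ parent v → parentEdgeColour v ≡ parent (parent v)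
  parentEdgeColour-nonroot {v} nonroot with parent (parent v) ≟ parent v
  ... | yes root = ⊥-elim (nonroot root)
  ... | no _ = refl

  parentEdgeColour≢parent : ∀ {v} → v ≢ hub → parentEdgeColour v ≢ parent v
  parentEdgeColour≢parent {v} v≢hub with parent (parent v) ≟ parent v
  ... | yes root = proj₂ (Rotation.rotate-isChild (parent≢hub v≢hub , root) v)
  ... | no nonroot = nonroot

  parentEdgeColour≢self : ∀ {v} → parent v ≢ v → parentEdgeColour v ≢ v
  parentEdgeColour≢self {v} pv≢v with parent (parent v) ≟ parent v
  ... | yes root = Rotation.rotate≢ (parent≢hub (nonroot≢hub pv≢v) , root) (refl , pv≢v ∘ sym)
  ... | no nonroot = λ ppv≡v → parent-asym refl ppv≡v (pv≢v ∘ sym)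

  childEdgeColour≢parentEdgeColour : ∀ {i j} → parent i ≢ i → IsChildOf j i → parentEdgeColour j ≢ parentEdgeColour i
  childEdgeColour≢parentEdgeColour {i} pi≢i (refl , _) pecj≡peci =
    parentEdgeColour≢parent (nonroot≢hub pi≢i) (sym (trans (sym (parentEdgeColour-nonroot pi≢i)) pecj≡peci))

  siblingEdgeColours-distinct : ∀ {i j k} → i ≢ hub → IsChildOf j i → IsChildOf k i → j ≢ k →
                                parentEdgeColour j ≢ parentEdgeColour k
  siblingEdgeColours-distinct {i} {j} {k} i≢hub (pj≡i , j≢i) (pk≡i , k≢i) j≢k with parent i ≟ i
  ... | no pi≢i = ⊥-elim (j≢k (nonroot-child-unique pi≢i pj≡i pk≡i))
  ... | yes pi≡i = λ pecj≡peck → j≢k (Rotation.rotate-injective root (pj≡i , j≢i) (pk≡i , k≢i) (begin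
        rotate i j                ≡⟨ cong (λ p → rotate p j) pj≡i ⟨
        rotate (parent j) j       ≡⟨ parentEdgeColour-root (ancestor-root pj≡i) ⟨
        parentEdgeColour j        ≡⟨ pecj≡peck ⟩
        parentEdgeColour k        ≡⟨ parentEdgeColour-root (ancestor-root pk≡i) ⟩
        rotate (parent k) k       ≡⟨ cong (λ p → rotate p k) pk≡i ⟩
        rotate i k                ∎))
    where
      open ≡-Reasoning
      root : IsRoot i
      root = i≢hub , pi≡i
      ancestor-root : ∀ {v} → parent v ≡ i → parent (parent v) ≡ parent v
      ancestor-root pv≡i = trans (cong parent pv≡i) (trans pi≡i (sym pv≡i))

  hub? : ∀ v → v ≡ hub ⊎ v ≢ hub
  hub? v = toSum (v ≟ hub)

  colour : Fin n → Fin n → Fin n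
  colour u v with u ≟ hub | v ≟ hub | parent v ≟ u
  ... | yes _ | _ | _ = v
  ... | no _ | yes _ | _ = u
  ... | no _ | no _ | yes _ = parentEdgeColour v
  ... | no _ | no _ | no _ = parentEdgeColour u

  colour-hub : ∀ v → colour hub v ≡ v
  colour-hub v with hub ≟ hub
  ... | yes _ = refl
  ... | no hub≢hub = ⊥-elim (hub≢hub refl)

  colour-toHub : ∀ {u} → u ≢ hub → colour u hub ≡ u
  colour-toHub {u} u≢hub with u ≟ hub | hub ≟ hub
  ... | yes u≡hub | _ = ⊥-elim (u≢hub u≡hub)
  ... | no _ | yes _ = refl
  ... | no _ | no hub≢hub = ⊥-elim (hub≢hub refl)

  colour-down : ∀ {u v} → u ≢ hub → v ≢ hub → parent v ≡ u → colour u v ≡ parentEdgeColour v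
  colour-down {u} {v} u≢hub v≢hub pv≡u with u ≟ hub | v ≟ hub | parent v ≟ u
  ... | yes u≡hub | _ | _ = ⊥-elim (u≢hub u≡hub)
  ... | no _ | yes v≡hub | _ = ⊥-elim (v≢hub v≡hub)
  ... | no _ | no _ | yes _ = refl
  ... | no _ | no _ | no pv≢u = ⊥-elim (pv≢u pv≡u)

  colour-up : ∀ {u v} → u ≢ hub → v ≢ hub → parent v ≢ u → colour u v ≡ parentEdgeColour u
  colour-up {u} {v} u≢hub v≢hub pv≢u with u ≟ hub | v ≟ hub | parent v ≟ u
  ... | yes u≡hub | _ | _ = ⊥-elim (u≢hub u≡hub)
  ... | no _ | yes v≡hub | _ = ⊥-elim (v≢hub v≡hub)
  ... | no _ | no _ | yes pv≡u = ⊥-elim (pv≢u pv≡u)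
  ... | no _ | no _ | no _ = refl

  data Neighbour (i : Fin n) : Fin n → Set where
    hubN : Neighbour i hub
    childN : ∀ {j} → j ≢ hub → IsChildOf j i → Neighbour i j
    parentN : parent i ≢ i → Neighbour i (parent i)

  neighbour : ∀ {i j} → i ≢ hub → G i j ≡ true → Neighbour i j
  neighbour {i} {j} i≢hub g with j ≟ hub | G⇒Edge g
  ... | yes refl | _ = hubN
  ... | no _ | _ , inj₁ i≡hub = ⊥-elim (i≢hub i≡hub)
  ... | no j≢hub | _ , inj₂ (inj₁ j≡hub) = ⊥-elim (j≢hub j≡hub)
  ... | no _ | i≢j , inj₂ (inj₂ (inj₁ refl)) = parentN (≢-sym i≢j)
  ... | no j≢hub | i≢j , inj₂ (inj₂ (inj₂ pj≡i)) = childN j≢hub (pj≡i , ≢-sym i≢j)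

  neighbourColour : ∀ {i j} → Neighbour i j → Fin n
  neighbourColour {i} hubN = i
  neighbourColour {j = j} (childN _ _) = parentEdgeColour j
  neighbourColour {i} (parentN _) = parentEdgeColour i

  colour-neighbour : ∀ {i j} → i ≢ hub → (nb : Neighbour i j) → colour i j ≡ neighbourColour nb
  colour-neighbour i≢hub hubN = colour-toHub i≢hub
  colour-neighbour i≢hub (childN j≢hub (pj≡i , _)) = colour-down i≢hub j≢hub pj≡i
  colour-neighbour i≢hub (parentN pi≢i) =
    colour-up i≢hub (parent≢hub i≢hub) (λ ppi≡i → parent-asym refl ppi≡i (pi≢i ∘ sym))

  neighbourColour-distinct : ∀ {i j k} → i ≢ hub → (nj : Neighbour i j) (nk : Neighbour i k) → j ≢ k →
                             neighbourColour nj ≢ neighbourColour nk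
  neighbourColour-distinct _ hubN hubN j≢k = ⊥-elim (j≢k refl)
  neighbourColour-distinct _ hubN (childN k≢hub (refl , _)) _ = ≢-sym (parentEdgeColour≢parent k≢hub)
  neighbourColour-distinct _ hubN (parentN pi≢i) _ = ≢-sym (parentEdgeColour≢self pi≢i)
  neighbourColour-distinct _ (childN j≢hub (refl , _)) hubN _ = parentEdgeColour≢parent j≢hub
  neighbourColour-distinct _ (parentN pi≢i) hubN _ = parentEdgeColour≢self pi≢i
  neighbourColour-distinct i≢hub (childN _ jc) (childN _ kc) j≢k = siblingEdgeColours-distinct i≢hub jc kc j≢k
  neighbourColour-distinct _ (childN _ jc) (parentN pi≢i) _ = childEdgeColour≢parentEdgeColour pi≢i jc
  neighbourColour-distinct _ (parentN pi≢i) (childN _ kc) _ = ≢-sym (childEdgeColour≢parentEdgeColour pi≢i kc)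
  neighbourColour-distinct _ (parentN _) (parentN _) j≢k = ⊥-elim (j≢k refl)

  colour-sym : ∀ {i j} → G i j ≡ true → colour i j ≡ colour j i
  colour-sym {i} {j} g with hub? i
  ... | inj₁ refl = trans (colour-hub j) (sym (colour-toHub (≢-sym (proj₁ (G⇒Edge g)))))
  ... | inj₂ i≢hub with neighbour i≢hub g
  ...   | hubN = trans (colour-toHub i≢hub) (sym (colour-hub i))
  ...   | childN j≢hub (pj≡i , j≢i) =
          trans (colour-down i≢hub j≢hub pj≡i) (sym (colour-up j≢hub i≢hub (λ pi≡j → parent-asym pj≡i pi≡j j≢i)))
  ...   | parentN pi≢i =
          trans (colour-neighbour i≢hub (parentN pi≢i)) (sym (colour-down (parent≢hub i≢hub) i≢hub refl))

  colour-proper : ∀ {i j k} → G i j ≡ true → G i k ≡ true → j ≢ k → colour i j ≢ colour i k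
  colour-proper {i} {j} {k} gj gk j≢k with hub? i
  ... | inj₁ refl rewrite colour-hub j | colour-hub k = j≢k
  ... | inj₂ i≢hub rewrite colour-neighbour i≢hub (neighbour i≢hub gj) | colour-neighbour i≢hub (neighbour i≢hub gk) =
        neighbourColour-distinct i≢hub (neighbour i≢hub gj) (neighbour i≢hub gk) j≢k

  c₀ : Coloring n
  c₀ u v = toℕ (colour u v)

  c₀-proper : IsProper G c₀
  c₀-proper = (λ i j g → cong toℕ (colour-sym {i} {j} g))
            , (λ i j k gj gk j≢k → colour-proper {i} {j} {k} gj gk j≢k ∘ toℕ-injective)

  -- In a 4-cycle hub–b–d–e the middle vertex d is either a root with children b, e (and the rotation
  -- makes an opposite pair agree), or an inner vertex of a leg, whose parent edge has its grandparent's colour.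
  hub-4-cycle-repeats : ∀ {b d e} → b ≢ hub → d ≢ hub → e ≢ hub → b ≢ d → b ≢ e → d ≢ e →
                        parent b ≡ d ⊎ parent d ≡ b → parent d ≡ e ⊎ parent e ≡ d →
                        colour hub b ≡ colour d e ⊎ colour b d ≡ colour e hub
  hub-4-cycle-repeats b≢hub _ e≢hub b≢d b≢e d≢e (inj₁ refl) (inj₁ refl) =
    inj₂ (trans (colour-up b≢hub (parent≢hub b≢hub) (≢-sym b≢e))
         (trans (parentEdgeColour-nonroot (≢-sym d≢e)) (sym (colour-toHub e≢hub))))
  hub-4-cycle-repeats b≢hub d≢hub e≢hub b≢d b≢e d≢e (inj₂ refl) (inj₂ refl) =
    inj₁ (trans (colour-hub _) (sym (trans (colour-down d≢hub e≢hub refl) (parentEdgeColour-nonroot b≢d))))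
  hub-4-cycle-repeats _ _ _ _ b≢e _ (inj₂ pd≡b) (inj₁ pd≡e) = ⊥-elim (b≢e (trans (sym pd≡b) pd≡e))
  hub-4-cycle-repeats {b} {d} {e} b≢hub d≢hub e≢hub b≢d b≢e d≢e (inj₁ pb≡d) (inj₂ pe≡d) with parent d ≟ d
  ... | no pd≢d = ⊥-elim (b≢e (nonroot-child-unique pd≢d pb≡d pe≡d))
  ... | yes pd≡d with Rotation.rotate-links (d≢hub , pd≡d) (pb≡d , b≢d) (pe≡d , ≢-sym d≢e) b≢e
  ...   | inj₁ rb≡e = inj₂ (begin
          colour b d              ≡⟨ colour-up b≢hub d≢hub (λ pd≡b → b≢d (trans (sym pd≡b) pd≡d)) ⟩
          parentEdgeColour b      ≡⟨ parentEdgeColour-root (trans (cong parent pb≡d) (trans pd≡d (sym pb≡d))) ⟩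
          rotate (parent b) b     ≡⟨ cong (λ p → rotate p b) pb≡d ⟩
          rotate d b              ≡⟨ rb≡e ⟩
          e                       ≡⟨ colour-toHub e≢hub ⟨
          colour e hub            ∎)
    where open ≡-Reasoning
  ...   | inj₂ re≡b = inj₁ (begin
          colour hub b            ≡⟨ colour-hub b ⟩
          b                       ≡⟨ re≡b ⟨
          rotate d e              ≡⟨ cong (λ p → rotate p e) pe≡d ⟨
          rotate (parent e) e     ≡⟨ parentEdgeColour-root (trans (cong parent pe≡d) (trans pd≡d (sym pe≡d))) ⟨
          parentEdgeColour e      ≡⟨ colour-down d≢hub e≢hub pe≡d ⟨
          colour d e              ∎)
    where open ≡-Reasoning

  no-rainbow-C₄ : ¬ HasRainbowC4 G c₀
  no-rainbow-C₄ (a , b , d , e , (ab , ad , ae , bd , be , de) , (gab , gbd , gde , gea) , (_ , c₂ , _ , _ , c₅ , _))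
    with hub? a | hub? b | hub? d | hub? e
  ... | inj₁ refl | _ | _ | _ =
    [ c₂ ∘ cong toℕ , c₅ ∘ cong toℕ ]′
      (hub-4-cycle-repeats (≢-sym ab) (≢-sym ad) (≢-sym ae) bd be de
        (forest-edge (≢-sym ab) (≢-sym ad) gbd) (forest-edge (≢-sym ad) (≢-sym ae) gde))
  ... | inj₂ a≢hub | inj₁ refl | _ | _ =
    [ c₅ ∘ cong toℕ , c₂ ∘ sym ∘ cong toℕ ]′
      (hub-4-cycle-repeats (≢-sym bd) (≢-sym be) a≢hub de (≢-sym ad) (≢-sym ae)
        (forest-edge (≢-sym bd) (≢-sym be) gde) (forest-edge (≢-sym be) a≢hub gea))
  ... | inj₂ a≢hub | inj₂ b≢hub | inj₁ refl | _ =
    [ c₂ ∘ sym ∘ cong toℕ , c₅ ∘ sym ∘ cong toℕ ]′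
      (hub-4-cycle-repeats (≢-sym de) a≢hub b≢hub (≢-sym ae) (≢-sym be) ab
        (forest-edge (≢-sym de) a≢hub gea) (forest-edge a≢hub b≢hub gab))
  ... | inj₂ a≢hub | inj₂ b≢hub | inj₂ d≢hub | inj₁ refl =
    [ c₅ ∘ sym ∘ cong toℕ , c₂ ∘ cong toℕ ]′
      (hub-4-cycle-repeats a≢hub b≢hub d≢hub ab ad bd (forest-edge a≢hub b≢hub gab) (forest-edge b≢hub d≢hub gbd))
  ... | inj₂ a≢hub | inj₂ b≢hub | inj₂ d≢hub | inj₂ e≢hub =
    no-forest-4-cycle ab ad ae bd be de (forest-edge a≢hub b≢hub gab) (forest-edge b≢hub d≢hub gbd)
                                        (forest-edge d≢hub e≢hub gde) (forest-edge e≢hub a≢hub gea)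

-- Proper colourings of supergraphs without rainbow C₄

two-subsingletons-cannot-cover-three : ∀ {A : Set} {P Q : A → Set} {a b d : A} → a ≢ b → a ≢ d → b ≢ d →
                   (∀ {v w} → P v → P w → v ≡ w) → (∀ {v w} → Q v → Q w → v ≡ w) →
                   P a ⊎ Q a → P b ⊎ Q b → P d ⊎ Q d → ⊥
two-subsingletons-cannot-cover-three a≢b _ _ P-unique _ (inj₁ pa) (inj₁ pb) _ = a≢b (P-unique pa pb)
two-subsingletons-cannot-cover-three _ a≢d _ P-unique _ (inj₁ pa) _ (inj₁ pd) = a≢d (P-unique pa pd)
two-subsingletons-cannot-cover-three _ _ b≢d P-unique _ _ (inj₁ pb) (inj₁ pd) = b≢d (P-unique pb pd)
two-subsingletons-cannot-cover-three a≢b _ _ _ Q-unique (inj₂ qa) (inj₂ qb) _ = a≢b (Q-unique qa qb)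
two-subsingletons-cannot-cover-three _ a≢d _ _ Q-unique (inj₂ qa) _ (inj₂ qd) = a≢d (Q-unique qa qd)
two-subsingletons-cannot-cover-three _ _ b≢d _ Q-unique _ (inj₂ qb) (inj₂ qd) = b≢d (Q-unique qb qd)

module RainbowFreeSupergraph {n : ℕ} {hub : Fin n} {parent : Fin n → Fin n} (F : SpiderForest toℕ hub parent)
  (H : Graph n) (H-sym : ∀ {i j} → H i j ≡ true → H j i ≡ true)
  (G⊆H : ∀ {i j} → HubJoin.G F i j ≡ true → H i j ≡ true)
  (c : Coloring n) (c-proper : IsProper H c) (rainbow-free : ¬ HasRainbowC4 H c) where
  open SpiderForest F
  open HubJoin F
    using (G; Edge⇒G; edge?; hub-edge; parent-edge; child<parent; child≢hub; nonroot≢hub; child≢grandparent;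
           other-children; third-child; child-or-leaf)

  c-sym : ∀ {u v} → H u v ≡ true → c u v ≡ c v u
  c-sym {u} {v} = proj₁ c-proper u v

  c-distinct : ∀ {i j k} → H i j ≡ true → H i k ≡ true → j ≢ k → c i j ≢ c i k
  c-distinct {i} {j} {k} = proj₂ c-proper i j k

  -- Adjacent edges differ by properness, so a non-rainbow 4-cycle repeats a colour on opposite edges.
  opposite-colours : ∀ {a b d e} → a ≢ b → a ≢ d → a ≢ e → b ≢ d → b ≢ e → d ≢ e →
                     H a b ≡ true → H b d ≡ true → H d e ≡ true → H e a ≡ true →
                     c a b ≡ c d e ⊎ c b d ≡ c e a
  opposite-colours {a} {b} {d} {e} ab ad ae bd be de hab hbd hde hea with c a b ℕ.≟ c d e | c b d ℕ.≟ c e a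
  ... | yes ab~de | _ = inj₁ ab~de
  ... | no _ | yes bd~ea = inj₂ bd~ea
  ... | no ab≁de | no bd≁ea = ⊥-elim (rainbow-free (a , b , d , e , (ab , ad , ae , bd , be , de) , (hab , hbd , hde , hea) ,
        (ab≁bd , ab≁de , ab≁ea , bd≁de , bd≁ea , de≁ea)))
    where
      ab≁bd : c a b ≢ c b d
      ab≁bd = c-distinct (H-sym hab) hbd ad ∘ trans (sym (c-sym hab))
      ab≁ea : c a b ≢ c e a
      ab≁ea eq = c-distinct hab (H-sym hea) be (trans eq (c-sym hea))
      bd≁de : c b d ≢ c d e
      bd≁de = c-distinct (H-sym hbd) hde be ∘ trans (sym (c-sym hbd))
      de≁ea : c d e ≢ c e a
      de≁ea = c-distinct (H-sym hde) hea (≢-sym ad) ∘ trans (sym (c-sym hde))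

  H-hub : ∀ {v} → v ≢ hub → H hub v ≡ true
  H-hub v≢hub = G⊆H (hub-edge v≢hub)

  H-toHub : ∀ {v} → v ≢ hub → H v hub ≡ true
  H-toHub = H-sym ∘ H-hub

  H-up : ∀ {a u} → IsChildOf a u → H a u ≡ true
  H-up (pa≡u , a≢u) = G⊆H (parent-edge pa≡u a≢u)

  H-down : ∀ {a u} → IsChildOf a u → H u a ≡ true
  H-down = H-sym ∘ H-up

  parent-isChild : ∀ {u} → parent u ≢ u → IsChildOf u (parent u)
  parent-isChild pu≢u = refl , pu≢u ∘ sym

  c-injective : ∀ {i j k} → H i j ≡ true → H i k ≡ true → c i j ≡ c i k → j ≡ k
  c-injective {j = j} {k} hij hik ij~ik = decidable-stable (j ≟ k) λ j≢k → c-distinct hij hik j≢k ij~ik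

  hub-colour-injective : ∀ {a b} → a ≢ hub → b ≢ hub → c hub a ≡ c hub b → a ≡ b
  hub-colour-injective a≢hub b≢hub = c-injective (H-hub a≢hub) (H-hub b≢hub)

  hub-cycle : ∀ {a b d} → a ≢ hub → b ≢ hub → d ≢ hub → a ≢ b → a ≢ d → b ≢ d → H a b ≡ true → H b d ≡ true →
              c hub a ≡ c b d ⊎ c a b ≡ c hub d
  hub-cycle a≢hub b≢hub d≢hub a≢b a≢d b≢d hab hbd
    with opposite-colours (≢-sym a≢hub) (≢-sym b≢hub) (≢-sym d≢hub) a≢b a≢d b≢d (H-hub a≢hub) hab hbd (H-toHub d≢hub)
  ... | inj₁ ha~bd = inj₁ ha~bd
  ... | inj₂ ab~dh = inj₂ (trans ab~dh (c-sym (H-toHub d≢hub)))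

  sibling-cycle : ∀ {o a b} → o ≢ hub → IsChildOf a o → IsChildOf b o → a ≢ b →
                  c hub a ≡ c o b ⊎ c a o ≡ c hub b
  sibling-cycle o≢hub a-child@(pa , a≢o) b-child@(pb , b≢o) a≢b =
    hub-cycle (child≢hub pa o≢hub) o≢hub (child≢hub pb o≢hub) a≢o a≢b (≢-sym b≢o) (H-up a-child) (H-down b-child)

  rootEdge-siblingColour : ∀ {o a} → IsRoot o → IsChildOf a o →
                           Σ[ s ∈ Fin n ] IsChildOf s o × c a o ≡ c hub s
  rootEdge-siblingColour root@(o≢hub , _) a-child with other-children root a-child
  ... | b , d , b-child , d-child , b≢a , d≢a , b≢d
      with sibling-cycle o≢hub a-child b-child (≢-sym b≢a) | sibling-cycle o≢hub a-child d-child (≢-sym d≢a)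
  ...   | inj₂ ao~hb | _ = b , b-child , ao~hb
  ...   | inj₁ _ | inj₂ ao~hd = d , d-child , ao~hd
  ...   | inj₁ ha~ob | inj₁ ha~od = ⊥-elim (b≢d (c-injective (H-down b-child) (H-down d-child) (trans (sym ha~ob) ha~od)))

  siblings-not-swapped : ∀ {o a b} → IsRoot o → IsChildOf a o → IsChildOf b o → a ≢ b →
                         c a o ≡ c hub b → c b o ≡ c hub a → ⊥
  siblings-not-swapped root@(o≢hub , _) a-child b-child@(pb , _) a≢b ao~hb bo~ha with third-child root a-child
  ... | d , d-child@(pd , _) , d≢a , d≢b with sibling-cycle o≢hub a-child d-child (≢-sym d≢a)
  ...   | inj₁ ha~od = d≢b (c-injective (H-down d-child) (H-down b-child)
                              (trans (sym ha~od) (trans (sym bo~ha) (c-sym (H-up b-child)))))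
  ...   | inj₂ ao~hd = d≢b (hub-colour-injective (child≢hub pd o≢hub) (child≢hub pb o≢hub) (trans (sym ao~hd) ao~hb))

  data ParentColour (u : Fin n) : Set where
    sibling : IsRoot (parent u) → ∀ s → IsChildOf s (parent u) → c u (parent u) ≡ c hub s → ParentColour u
    grandparent : parent (parent u) ≢ parent u → c u (parent u) ≡ c hub (parent (parent u)) → ParentColour u

  parentColour≢childHubColour : ∀ {u w} → parent u ≢ u → ParentColour u → IsChildOf w u → c u (parent u) ≢ c hub w
  parentColour≢childHubColour pu≢u (sibling root s (ps , _) up~hs) (pw , _) up~hw =
    pu≢u (trans (sym ps) (trans (cong parent s≡w) pw))
    where
      s≡w = hub-colour-injective (child≢hub ps (proj₁ root)) (child≢hub pw (nonroot≢hub pu≢u)) (trans (sym up~hs) up~hw)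
  parentColour≢childHubColour pu≢u (grandparent ppu≢pu up~hpp) (pw , w≢u) up~hw =
    <-irrefl (cong toℕ (sym ppu≡w))
             (<-trans (child<parent pw w≢u) (<-trans (parent-increasing pu≢u) (parent-increasing ppu≢pu)))
    where
      u≢hub = nonroot≢hub pu≢u
      ppu≡w = hub-colour-injective (parent≢hub (parent≢hub u≢hub)) (child≢hub pw u≢hub) (trans (sym up~hpp) up~hw)

  parentColour : ∀ u → parent u ≢ u → ParentColour u
  parentColour = All.wfRec >-wellFounded 0ℓ (λ u → parent u ≢ u → ParentColour u) step
    where
      step : ∀ u → (∀ {v} → toℕ u < toℕ v → parent v ≢ v → ParentColour v) → parent u ≢ u → ParentColour u
      step u rec pu≢u with parent (parent u) ≟ parent u
      ... | yes ppu≡pu with rootEdge-siblingColour (parent≢hub (nonroot≢hub pu≢u) , ppu≡pu) (parent-isChild pu≢u)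
      ...   | s , s-child , up~hs = sibling (parent≢hub (nonroot≢hub pu≢u) , ppu≡pu) s s-child up~hs
      step u rec pu≢u | no ppu≢pu
        with hub-cycle u≢hub (parent≢hub u≢hub) (parent≢hub (parent≢hub u≢hub)) (pu≢u ∘ sym)
                       (child≢grandparent (parent-isChild pu≢u) ppu≢pu) (ppu≢pu ∘ sym)
                       (H-up (parent-isChild pu≢u)) (H-up (parent-isChild ppu≢pu))
        where u≢hub = nonroot≢hub pu≢u
      ... | inj₁ hu~ppp = ⊥-elim (parentColour≢childHubColour ppu≢pu (rec (parent-increasing pu≢u) ppu≢pu)
                                                              (parent-isChild pu≢u) (sym hu~ppp))
      ... | inj₂ upu~hpp = grandparent ppu≢pu upu~hpp

  childEdgeColour : ∀ {u v} → parent u ≢ u → IsChildOf v u → c u v ≡ c hub (parent u)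
  childEdgeColour {u} pu≢u v-child@(pv , v≢u)
    with hub-cycle (child≢hub pv u≢hub) u≢hub (parent≢hub u≢hub) v≢u (child≢grandparent v-child pu≢u) (pu≢u ∘ sym)
                   (H-up v-child) (H-up (parent-isChild pu≢u))
    where u≢hub = nonroot≢hub pu≢u
  ... | inj₁ hv~upu = ⊥-elim (parentColour≢childHubColour pu≢u (parentColour u pu≢u) v-child (sym hv~upu))
  ... | inj₂ vu~hpu = trans (c-sym (H-down v-child)) vu~hpu

  record NewEdge (x y : Fin n) : Set where
    field
      x≢hub : x ≢ hub
      y≢hub : y ≢ hub
      x≢y : x ≢ y
      H-xy : H x y ≡ true
      px≢y : parent x ≢ y
      py≢x : parent y ≢ x

  NewEdge-sym : ∀ {x y} → NewEdge x y → NewEdge y x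
  NewEdge-sym E = record { x≢hub = y≢hub ; y≢hub = x≢hub ; x≢y = ≢-sym x≢y ; H-xy = H-sym H-xy ; px≢y = py≢x ; py≢x = px≢y }
    where open NewEdge E

  module _ {x y : Fin n} (E : NewEdge x y) where
    open NewEdge E

    new-edge-cycle : ∀ {a} → a ≢ hub → a ≢ y → a ≢ x → H a x ≡ true → c a x ≢ c hub y → c hub a ≡ c x y
    new-edge-cycle a≢hub a≢y a≢x hax ax≁hy with hub-cycle a≢hub x≢hub y≢hub a≢x a≢y x≢y hax H-xy
    ... | inj₁ ha~xy = ha~xy
    ... | inj₂ ax~hy = ⊥-elim (ax≁hy ax~hy)

    new-edge-parent : parent x ≢ x → c x (parent x) ≢ c hub y → c hub (parent x) ≡ c x y
    new-edge-parent px≢x xp≁hy =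
      new-edge-cycle (parent≢hub x≢hub) px≢y px≢x (H-down (parent-isChild px≢x))
                     (xp≁hy ∘ trans (c-sym (H-up (parent-isChild px≢x))))

    child≢y : ∀ {a} → IsChildOf a x → a ≢ y
    child≢y (pa , _) a≡y = py≢x (subst (λ v → parent v ≡ x) a≡y pa)

    new-edge-child : ∀ {a} → parent x ≢ x → IsChildOf a x → c hub a ≡ c x y
    new-edge-child px≢x a-child@(pa , a≢x) = new-edge-cycle (child≢hub pa x≢hub) (child≢y a-child) a≢x (H-up a-child) λ ax~hy →
      px≢y (hub-colour-injective (parent≢hub x≢hub) y≢hub
        (trans (sym (childEdgeColour px≢x a-child)) (trans (c-sym (H-down a-child)) ax~hy)))

    -- Every child a of a root x closes the 4-cycle hub–a–x–y, so it is of one of two kinds;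
    -- each kind has at most one member, but x has three children.
    root-endpoint-impossible : parent x ≡ x → ⊥
    root-endpoint-impossible px≡x =
      two-subsingletons-cannot-cover-three (child₁≢child₂ root) (child₁≢child₃ root) (child₂≢child₃ root)
        toHubColour-unique hubColour-unique
        (kind (child₁-isChild root)) (kind (child₂-isChild root)) (kind (child₃-isChild root))
      where
        root : IsRoot x
        root = x≢hub , px≡x
        kind : ∀ {a} → IsChildOf a x → (IsChildOf a x × c a x ≡ c hub y) ⊎ (a ≢ hub × c hub a ≡ c x y)
        kind {a} a-child@(pa , a≢x) with c a x ℕ.≟ c hub y
        ... | yes ax~hy = inj₁ (a-child , ax~hy)
        ... | no ax≁hy = inj₂ (child≢hub pa x≢hub , new-edge-cycle (child≢hub pa x≢hub) (child≢y a-child) a≢x (H-up a-child) ax≁hy)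
        toHubColour-unique : ∀ {a b} → IsChildOf a x × c a x ≡ c hub y → IsChildOf b x × c b x ≡ c hub y → a ≡ b
        toHubColour-unique {a} {b} (a-child , ax~hy) (b-child , bx~hy) = decidable-stable (a ≟ b) λ a≢b →
          c-distinct (H-down a-child) (H-down b-child) a≢b
            (trans (c-sym (H-down a-child)) (trans ax~hy (trans (sym bx~hy) (sym (c-sym (H-down b-child))))))
        hubColour-unique : ∀ {a b} → a ≢ hub × c hub a ≡ c x y → b ≢ hub × c hub b ≡ c x y → a ≡ b
        hubColour-unique (a≢hub , ha~xy) (b≢hub , hb~xy) = hub-colour-injective a≢hub b≢hub (trans ha~xy (sym hb~xy))

    parentEdge-hubColour⇒sibling : parent x ≢ x → IsLeaf y → c x (parent x) ≡ c hub y → IsRoot (parent x) × IsChildOf y (parent x)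
    parentEdge-hubColour⇒sibling px≢x leaf-y xp~hy with parentColour x px≢x
    ... | grandparent ppx≢px xp~hpp =
          ⊥-elim (px≢y (leaf-y (parent x) (hub-colour-injective (parent≢hub (parent≢hub x≢hub)) y≢hub (trans (sym xp~hpp) xp~hy))))
    ... | sibling root s (ps , s≢px) xp~hs with hub-colour-injective (child≢hub ps (proj₁ root)) y≢hub (trans (sym xp~hs) xp~hy)
    ...   | refl = root , ps , s≢px

    leaves-parentEdge-hubColour⇒⊥ : parent x ≢ x → IsLeaf x → IsLeaf y → c x (parent x) ≡ c hub y → ⊥
    leaves-parentEdge-hubColour⇒⊥ px≢x leaf-x leaf-y xp~hy with parentEdge-hubColour⇒sibling px≢x leaf-y xp~hy
    ... | root , y-child = x≢y (leaf-child-unique root (parent-isChild px≢x) y-child leaf-x leaf-y)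

  module _ {x y : Fin n} (E : NewEdge x y) where
    open NewEdge E

    leaf-parent-hubColour : parent x ≢ x → parent y ≢ y → IsLeaf y → c hub (parent x) ≡ c x y
    leaf-parent-hubColour px≢x py≢y leaf-y with c x (parent x) ℕ.≟ c hub y
    ... | no xp≁hy = new-edge-parent E px≢x xp≁hy
    ... | yes xp~hy with parentEdge-hubColour⇒sibling E px≢x leaf-y xp~hy
    ...   | root , py≡px , y≢px with c y (parent y) ℕ.≟ c hub x
    ...     | yes yp~hx = ⊥-elim (siblings-not-swapped root (parent-isChild px≢x) (py≡px , y≢px) x≢y xp~hy
                                    (subst (λ p → c y p ≡ c hub x) py≡px yp~hx))
    ...     | no yp≁hx = begin
                c hub (parent x) ≡⟨ cong (c hub) py≡px ⟨
                c hub (parent y) ≡⟨ new-edge-parent (NewEdge-sym E) py≢y yp≁hx ⟩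
                c y x            ≡⟨ c-sym H-xy ⟨
                c x y            ∎
      where open ≡-Reasoning

    child-vs-leaf : parent x ≢ x → parent y ≢ y → ∀ {a} → IsChildOf a x → IsLeaf y → ⊥
    child-vs-leaf px≢x py≢y a-child@(pa , _) leaf-y =
      child≢grandparent a-child px≢x (hub-colour-injective (child≢hub pa x≢hub) (parent≢hub x≢hub)
        (trans (new-edge-child E px≢x a-child) (sym (leaf-parent-hubColour px≢x py≢y leaf-y))))

    leaf-vs-leaf : parent x ≢ x → parent y ≢ y → IsLeaf x → IsLeaf y → ⊥
    leaf-vs-leaf px≢x py≢y leaf-x leaf-y with c x (parent x) ℕ.≟ c hub y | c y (parent y) ℕ.≟ c hub x
    ... | yes xp~hy | _ = leaves-parentEdge-hubColour⇒⊥ E px≢x leaf-x leaf-y xp~hy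
    ... | no _ | yes yp~hx = leaves-parentEdge-hubColour⇒⊥ (NewEdge-sym E) py≢y leaf-y leaf-x yp~hx
    ... | no xp≁hy | no yp≁hx
        with hub-colour-injective (parent≢hub x≢hub) (parent≢hub y≢hub)
               (trans (new-edge-parent E px≢x xp≁hy) (trans (c-sym H-xy) (sym (new-edge-parent (NewEdge-sym E) py≢y yp≁hx))))
           | parent (parent x) ≟ parent x
    ...   | px≡py | no ppx≢px = x≢y (nonroot-child-unique ppx≢px refl (sym px≡py))
    ...   | px≡py | yes ppx≡px = x≢y (leaf-child-unique (parent≢hub x≢hub , ppx≡px) (parent-isChild px≢x)
                                                        (sym px≡py , px≢y ∘ sym) leaf-x leaf-y)

  new-edge-impossible : ∀ {x y} → NewEdge x y → ⊥
  new-edge-impossible {x} {y} E with parent x ≟ x | parent y ≟ y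
  ... | yes px≡x | _ = root-endpoint-impossible E px≡x
  ... | no _ | yes py≡y = root-endpoint-impossible (NewEdge-sym E) py≡y
  ... | no px≢x | no py≢y with child-or-leaf x | child-or-leaf y
  ...   | inj₁ (a , a-child@(pa , _)) | inj₁ (b , b-child@(pb , _)) =
          x≢y (trans (sym pa) (trans (cong parent a≡b) pb))
    where
      open NewEdge E
      a≡b = hub-colour-injective (child≢hub pa x≢hub) (child≢hub pb y≢hub)
              (trans (new-edge-child E px≢x a-child) (trans (c-sym H-xy) (sym (new-edge-child (NewEdge-sym E) py≢y b-child))))
  ...   | inj₁ (a , a-child) | inj₂ leaf-y = child-vs-leaf E px≢x py≢y a-child leaf-y
  ...   | inj₂ leaf-x | inj₁ (b , b-child) = child-vs-leaf (NewEdge-sym E) py≢y px≢x b-child leaf-x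
  ...   | inj₂ leaf-x | inj₂ leaf-y = leaf-vs-leaf E px≢x py≢y leaf-x leaf-y

  H⊆G : ∀ {x y} → x ≢ y → H x y ≡ true → G x y ≡ true
  H⊆G {x} {y} x≢y hxy with edge? x y
  ... | yes edge = Edge⇒G edge
  ... | no ¬edge = ⊥-elim (new-edge-impossible (record
        { x≢hub = λ x≡hub → ¬edge (x≢y , inj₁ x≡hub)
        ; y≢hub = λ y≡hub → ¬edge (x≢y , inj₂ (inj₁ y≡hub))
        ; x≢y = x≢y
        ; H-xy = hxy
        ; px≢y = λ px≡y → ¬edge (x≢y , inj₂ (inj₂ (inj₁ px≡y)))
        ; py≢x = λ py≡x → ¬edge (x≢y , inj₂ (inj₂ (inj₂ py≡x)))
        }))

-- Saturation and size of the hub join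

hasRainbowC4? : ∀ {n} (G : Graph n) (c : Coloring n) → Dec (HasRainbowC4 G c)
hasRainbowC4? G c = any? λ a → any? λ b → any? λ d → any? λ e →
  (¬? (a ≟ b) ×-dec ¬? (a ≟ d) ×-dec ¬? (a ≟ e) ×-dec ¬? (b ≟ d) ×-dec ¬? (b ≟ e) ×-dec ¬? (d ≟ e))
  ×-dec (G a b 𝔹.≟ true ×-dec G b d 𝔹.≟ true ×-dec G d e 𝔹.≟ true ×-dec G e a 𝔹.≟ true)
  ×-dec (¬? (c a b ℕ.≟ c b d) ×-dec ¬? (c a b ℕ.≟ c d e) ×-dec ¬? (c a b ℕ.≟ c e a) ×-dec
         ¬? (c b d ℕ.≟ c d e) ×-dec ¬? (c b d ℕ.≟ c e a) ×-dec ¬? (c d e ℕ.≟ c e a))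

module _ {n : ℕ} (G : Graph n) (x y : Fin n) where
  addEdge-⊇ : ∀ {i j} → G i j ≡ true → addEdge G x y i j ≡ true
  addEdge-⊇ gij = cong (_∨ _) gij

  addEdge-new : addEdge G x y x y ≡ true
  addEdge-new = trans (cong₂ (λ p q → G x y ∨ ((p ∧ q) ∨ (does (x ≟ y) ∧ does (y ≟ x)))) (dec-true (x ≟ x) refl) (dec-true (y ≟ y) refl))
                      (∨-zeroʳ (G x y))

  addEdge-sym : (∀ i j → G i j ≡ G j i) → ∀ i j → addEdge G x y i j ≡ addEdge G x y j i
  addEdge-sym G-sym i j = cong₂ _∨_ (G-sym i j) (trans (∨-comm (does (i ≟ x) ∧ does (j ≟ y)) (does (i ≟ y) ∧ does (j ≟ x)))
                                                      (cong₂ _∨_ (∧-comm (does (i ≟ y)) _) (∧-comm (does (i ≟ x)) _)))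

hubJoin-saturated : ∀ {n} {hub : Fin n} {parent} (F : SpiderForest toℕ hub parent) → IsRainbowC4Saturated (HubJoin.G F)
hubJoin-saturated F = (c₀ , c₀-proper , no-rainbow-C₄) , saturation
  where
    open HubJoin F
    saturation : ∀ x y → x ≢ y → G x y ≡ false → ∀ c → IsProper (addEdge G x y) c → HasRainbowC4 (addEdge G x y) c
    saturation x y x≢y gxy≡false c c-proper = decidable-stable (hasRainbowC4? _ c) λ rainbow-free →
      contradiction (trans (sym gxy≡false)
        (RainbowFreeSupergraph.H⊆G F (addEdge G x y) (λ {i} {j} → trans (addEdge-sym G x y (proj₁ G-simple) j i))
                                    (λ {i} {j} → addEdge-⊇ G x y {i} {j}) c c-proper rainbow-free x≢y (addEdge-new G x y)))
        λ ()

-- Each edge is counted at its endpoint of smaller index: the hub (index 0) counts at most n edges,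
-- a root none, and every other vertex only the edge to its parent.
hubJoin-edgeCount : ∀ {n} {hub : Fin n} {parent} (F : SpiderForest toℕ hub parent) → toℕ hub ≡ 0 →
                    (w : Fin n → ℕ) → n ≤ w hub → (∀ {v} → parent v ≢ v → 1 ≤ w v) → edgeCount (HubJoin.G F) ≤ ∑ w
hubJoin-edgeCount {n} {hub} {parent} F hub-first w n≤w-hub nonroot⇒1≤w = edgeCount≤∑ G w row≤w
  where
    open HubJoin F

    upper-neighbour : ∀ {i j} → i ≢ hub → toℕ i < toℕ j → G i j ≡ true → parent i ≢ i × j ≡ parent i
    upper-neighbour i≢hub i<j g with neighbour i≢hub g
    ... | hubN = ⊥-elim (n≮0 (subst (_ <_) hub-first i<j))
    ... | childN _ (pj≡i , j≢i) = ⊥-elim (<-asym i<j (child<parent pj≡i j≢i))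
    ... | parentN pi≢i = pi≢i , refl

    row≤w : ∀ i → ∑ (upEdge G i) ≤ w i
    row≤w i with hub? i
    ... | inj₁ refl = begin
          ∑ (upEdge G hub)   ≤⟨ ∑-mono-≤ (upEdge≤1 G hub) ⟩
          ∑ {n} (λ _ → 1)    ≡⟨ trans (∑-const n 1) (*-identityʳ n) ⟩
          n                  ≤⟨ n≤w-hub ⟩
          w hub              ∎
      where open ≤-Reasoning
    ... | inj₂ i≢hub with parent i ≟ i
    ...   | yes pi≡i = ≤-trans (≤-reflexive (∑-zero λ j → upEdge-absent G i j λ i<j g →
                                 proj₁ (upper-neighbour i≢hub i<j g) pi≡i)) z≤n
    ...   | no pi≢i = begin
          ∑ (upEdge G i)          ≡⟨ ∑-single (parent i) (λ j j≢pi → upEdge-absent G i j λ i<j g →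
                                       j≢pi (proj₂ (upper-neighbour i≢hub i<j g))) ⟩
          upEdge G i (parent i)   ≤⟨ upEdge≤1 G i (parent i) ⟩
          1                       ≤⟨ nonroot⇒1≤w pi≢i ⟩
          w i                     ∎
      where open ≤-Reasoning

-- Relabelling, and an explicit spider forest

module _ {V W : Set} {rank : V → ℕ} {hub : V} {parent : V → V} (rank′ : W → ℕ) (f : V → W) (g : W → V)
         (g∘f : ∀ v → g (f v) ≡ v) (f∘g : ∀ w → f (g w) ≡ w) (rank′∘f : ∀ v → rank′ (f v) ≡ rank v) where

  f-injective : ∀ {u v} → f u ≡ f v → u ≡ v
  f-injective {u} {v} fu≡fv = trans (sym (g∘f u)) (trans (cong g fu≡fv) (g∘f v))

  g-injective : ∀ {u v} → g u ≡ g v → u ≡ v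
  g-injective {u} {v} gu≡gv = trans (sym (f∘g u)) (trans (cong f gu≡gv) (f∘g v))

  relabel : SpiderForest rank hub parent → SpiderForest rank′ (f hub) (f ∘ parent ∘ g)
  relabel F = record
    { parent-hub = trans (cong (f ∘ parent) (g∘f hub)) (cong f parent-hub)
    ; parent≢hub = λ w≢fhub → parent≢hub (≢fhub⁻ w≢fhub) ∘ f-injective
    ; parent-increasing = λ {w} pw≢w → subst₂ _<_ (rank∘g w) (sym (rank′∘f _)) (parent-increasing (pw≢w ∘ nonroot⁺))
    ; child₁ = f ∘ child₁ ∘ g
    ; child₂ = f ∘ child₂ ∘ g
    ; child₃ = f ∘ child₃ ∘ g
    ; child₁-isChild = child⁺ ∘ child₁-isChild ∘ root⁻
    ; child₂-isChild = child⁺ ∘ child₂-isChild ∘ root⁻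
    ; child₃-isChild = child⁺ ∘ child₃-isChild ∘ root⁻
    ; child₁≢child₂ = λ root → child₁≢child₂ (root⁻ root) ∘ f-injective
    ; child₁≢child₃ = λ root → child₁≢child₃ (root⁻ root) ∘ f-injective
    ; child₂≢child₃ = λ root → child₂≢child₃ (root⁻ root) ∘ f-injective
    ; root-children = λ {_} {a} root a-child → Sum.map (g⁺ a) (Sum.map (g⁺ a) (g⁺ a)) (root-children (root⁻ root) (child⁻ a-child))
    ; nonroot-child-unique = λ {x} px≢x pa≡x pb≡x →
        g-injective (nonroot-child-unique (px≢x ∘ nonroot⁺) (parent⁻ pa≡x) (parent⁻ pb≡x))
    ; leaf-child-unique = λ root a-child b-child a-leaf b-leaf →
        g-injective (leaf-child-unique (root⁻ root) (child⁻ a-child) (child⁻ b-child) (leaf⁻ a-leaf) (leaf⁻ b-leaf))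
    }
    where
      open SpiderForest F
      g⁺ : ∀ w {v} → g w ≡ v → w ≡ f v
      g⁺ w gw≡v = trans (sym (f∘g w)) (cong f gw≡v)
      ≢fhub⁻ : ∀ {w} → w ≢ f hub → g w ≢ hub
      ≢fhub⁻ {w} w≢fhub = w≢fhub ∘ g⁺ w
      parent⁻ : ∀ {a x} → f (parent (g a)) ≡ x → parent (g a) ≡ g x
      parent⁻ {a} pa≡x = trans (sym (g∘f _)) (cong g pa≡x)
      nonroot⁺ : ∀ {w} → parent (g w) ≡ g w → f (parent (g w)) ≡ w
      nonroot⁺ {w} pgw≡gw = trans (cong f pgw≡gw) (f∘g w)
      rank∘g : ∀ w → rank (g w) ≡ rank′ w
      rank∘g w = trans (sym (rank′∘f (g w))) (cong rank′ (f∘g w))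
      root⁻ : ∀ {r} → r ≢ f hub × f (parent (g r)) ≡ r → IsRoot (g r)
      root⁻ (r≢fhub , pr≡r) = ≢fhub⁻ r≢fhub , parent⁻ pr≡r
      child⁻ : ∀ {a r} → f (parent (g a)) ≡ r × a ≢ r → IsChildOf (g a) (g r)
      child⁻ (pa≡r , a≢r) = parent⁻ pa≡r , a≢r ∘ g-injective
      child⁺ : ∀ {a r} → IsChildOf a (g r) → f (parent (g (f a))) ≡ r × f a ≢ r
      child⁺ {a} {r} (pa≡gr , a≢gr) = trans (cong (f ∘ parent) (g∘f a)) (trans (cong f pa≡gr) (f∘g r))
                                     , λ fa≡r → a≢gr (trans (sym (g∘f a)) (cong g fa≡r))
      leaf⁻ : ∀ {a} → (∀ z → f (parent (g z)) ≡ a → z ≡ a) → IsLeaf (g a)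
      leaf⁻ {a} a-leaf z pz≡ga =
        trans (sym (g∘f z)) (cong g (a-leaf (f z) (trans (cong (f ∘ parent) (g∘f z)) (trans (cong f pz≡ga) (f∘g a)))))

data Position : Set where
  stub foot₁ foot₂ knee₁ knee₂ centre : Position

positionIndex : Position → Fin 6
positionIndex stub = fzero
positionIndex foot₁ = fsuc fzero
positionIndex foot₂ = fsuc (fsuc fzero)
positionIndex knee₁ = fsuc (fsuc (fsuc fzero))
positionIndex knee₂ = fsuc (fsuc (fsuc (fsuc fzero)))
positionIndex centre = fsuc (fsuc (fsuc (fsuc (fsuc fzero))))

position : Fin 6 → Position
position fzero = stub
position (fsuc fzero) = foot₁
position (fsuc (fsuc fzero)) = foot₂
position (fsuc (fsuc (fsuc fzero))) = knee₁
position (fsuc (fsuc (fsuc (fsuc fzero)))) = knee₂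
position (fsuc (fsuc (fsuc (fsuc (fsuc fzero))))) = centre

position-index : ∀ p → position (positionIndex p) ≡ p
position-index stub = refl
position-index foot₁ = refl
position-index foot₂ = refl
position-index knee₁ = refl
position-index knee₂ = refl
position-index centre = refl

index-position : ∀ l → positionIndex (position l) ≡ l
index-position fzero = refl
index-position (fsuc fzero) = refl
index-position (fsuc (fsuc fzero)) = refl
index-position (fsuc (fsuc (fsuc fzero))) = refl
index-position (fsuc (fsuc (fsuc (fsuc fzero)))) = refl
index-position (fsuc (fsuc (fsuc (fsuc (fsuc fzero))))) = refl

positionParent : Position → Position
positionParent stub = centre
positionParent foot₁ = knee₁
positionParent foot₂ = knee₂
positionParent knee₁ = centre
positionParent knee₂ = centre
positionParent centre = centre

positionParent-increasing : ∀ {p} → positionParent p ≢ p → toℕ (positionIndex p) < toℕ (positionIndex (positionParent p))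
positionParent-increasing {stub} _ = <ᵇ⇒< _ _ _
positionParent-increasing {foot₁} _ = <ᵇ⇒< _ _ _
positionParent-increasing {foot₂} _ = <ᵇ⇒< _ _ _
positionParent-increasing {knee₁} _ = <ᵇ⇒< _ _ _
positionParent-increasing {knee₂} _ = <ᵇ⇒< _ _ _
positionParent-increasing {centre} centre≢centre = ⊥-elim (centre≢centre refl)

positionChild : Position → Position
positionChild knee₁ = foot₁
positionChild knee₂ = foot₂
positionChild p = p

positionChild-parent : ∀ {p} → positionParent (positionParent p) ≢ positionParent p → positionChild (positionParent p) ≡ p
positionChild-parent {stub} nonroot = ⊥-elim (nonroot refl)
positionChild-parent {foot₁} _ = refl
positionChild-parent {foot₂} _ = refl
positionChild-parent {knee₁} nonroot = ⊥-elim (nonroot refl)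
positionChild-parent {knee₂} nonroot = ⊥-elim (nonroot refl)
positionChild-parent {centre} nonroot = ⊥-elim (nonroot refl)

positionWeight : Position → ℕ
positionWeight centre = 0
positionWeight _ = 1

-- suc t spiders on six vertices each, with a path of e extra vertices hanging below the stub of the first one.
module Spiders (e t : ℕ) where
  N : ℕ
  N = suc (e + suc t * 6)

  data Vertex : Set where
    hub : Vertex
    chain : Fin e → Vertex
    block : Fin (suc t) → Position → Vertex

  encode : Vertex → Fin N
  encode hub = fzero
  encode (chain i) = fsuc (i ↑ˡ (suc t * 6))
  encode (block k p) = fsuc (e ↑ʳ combine k (positionIndex p))

  block′ : Fin (suc t) × Fin 6 → Vertex
  block′ (k , l) = block k (position l)

  decode : Fin N → Vertex
  decode fzero = hub
  decode (fsuc w) = [ chain , block′ ∘ remQuot 6 ]′ (splitAt e w)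

  decode-chain : ∀ i → decode (fsuc (i ↑ˡ (suc t * 6))) ≡ chain i
  decode-chain i = cong [ chain , block′ ∘ remQuot 6 ]′ (splitAt-↑ˡ e i (suc t * 6))

  decode-block : ∀ k l → decode (fsuc (e ↑ʳ combine k l)) ≡ block k (position l)
  decode-block k l = trans (cong [ chain , block′ ∘ remQuot 6 ]′ (splitAt-↑ʳ e (suc t * 6) (combine k l)))
                           (cong block′ (remQuot-combine k l))

  decode-encode : ∀ v → decode (encode v) ≡ v
  decode-encode hub = refl
  decode-encode (chain i) = decode-chain i
  decode-encode (block k p) = trans (decode-block k (positionIndex p)) (cong (block k) (position-index p))

  encode-decode : ∀ w → encode (decode w) ≡ w
  encode-decode fzero = refl
  encode-decode (fsuc w) with splitAt e w in split
  ... | inj₁ i = cong fsuc (splitAt⁻¹-↑ˡ split)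
  ... | inj₂ b = cong fsuc (begin
          e ↑ʳ combine k (positionIndex (position l))  ≡⟨ cong (λ l′ → e ↑ʳ combine k l′) (index-position l) ⟩
          e ↑ʳ combine k l                             ≡⟨ cong (e ↑ʳ_) (combine-remQuot {suc t} 6 b) ⟩
          e ↑ʳ b                                       ≡⟨ splitAt⁻¹-↑ʳ split ⟩
          w                                            ∎)
    where
      open ≡-Reasoning
      k = proj₁ (remQuot {suc t} 6 b)
      l = proj₂ (remQuot {suc t} 6 b)

  rank : Vertex → ℕ
  rank = toℕ ∘ encode

  rank-chain : ∀ i → rank (chain i) ≡ suc (toℕ i)
  rank-chain i = cong suc (toℕ-↑ˡ i (suc t * 6))

  rank-block : ∀ k p → rank (block k p) ≡ suc (e + (6 * toℕ k + toℕ (positionIndex p)))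
  rank-block k p = cong suc (trans (toℕ-↑ʳ e _) (cong (e +_) (toℕ-combine k (positionIndex p))))

  chainParent : Fin e → Vertex
  chainParent i with suc (toℕ i) ℕ.<? e
  ... | yes i+1<e = chain (fromℕ< i+1<e)
  ... | no _ = block fzero stub

  parent : Vertex → Vertex
  parent hub = hub
  parent (chain i) = chainParent i
  parent (block k p) = block k (positionParent p)

  chain-injective : ∀ {i j} → chain i ≡ chain j → i ≡ j
  chain-injective refl = refl

  block-injective : ∀ {k k′ p p′} → block k p ≡ block k′ p′ → k ≡ k′ × p ≡ p′
  block-injective refl = refl , refl

  chain-end : ∀ {i : Fin e} → ¬ suc (toℕ i) < e → suc (toℕ i) ≡ e
  chain-end {i} i+1≮e = ≤-antisym (toℕ<n i) (≮⇒≥ i+1≮e)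

  chainParent-rank : ∀ i → rank (chain i) < rank (chainParent i)
  chainParent-rank i with suc (toℕ i) ℕ.<? e
  ... | yes i+1<e = subst₂ _<_ (sym (rank-chain i))
                      (sym (trans (rank-chain (fromℕ< i+1<e)) (cong suc (toℕ-fromℕ< i+1<e)))) (n<1+n _)
  ... | no _ = subst₂ _<_ (sym (rank-chain i)) (sym (trans (rank-block fzero stub) (cong suc (+-identityʳ e))))
                 (s≤s (toℕ<n i))

  chainParent≢hub : ∀ i → chainParent i ≢ hub
  chainParent≢hub i with suc (toℕ i) ℕ.<? e
  ... | yes _ = λ ()
  ... | no _ = λ ()

  chainParent-stub : ∀ i {k p} → chainParent i ≡ block k p → p ≡ stub
  chainParent-stub i with suc (toℕ i) ℕ.<? e
  ... | yes _ = λ ()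
  ... | no _ = λ { refl → refl }

  chainParent-injective : ∀ i j → chainParent i ≡ chainParent j → i ≡ j
  chainParent-injective i j with suc (toℕ i) ℕ.<? e | suc (toℕ j) ℕ.<? e
  ... | yes i+1<e | yes j+1<e = λ eq → toℕ-injective (suc-injective
        (trans (sym (toℕ-fromℕ< i+1<e)) (trans (cong toℕ (chain-injective eq)) (toℕ-fromℕ< j+1<e))))
  ... | yes _ | no _ = λ ()
  ... | no _ | yes _ = λ ()
  ... | no i+1≮e | no j+1≮e = λ _ → toℕ-injective (suc-injective (trans (chain-end i+1≮e) (sym (chain-end j+1≮e))))

  positionParent≢stub : ∀ p → positionParent p ≢ stub
  positionParent≢stub stub ()
  positionParent≢stub foot₁ ()
  positionParent≢stub foot₂ ()
  positionParent≢stub knee₁ ()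
  positionParent≢stub knee₂ ()
  positionParent≢stub centre ()

  parent-rank : ∀ {v} → parent v ≢ v → rank v < rank (parent v)
  parent-rank {hub} hub≢hub = ⊥-elim (hub≢hub refl)
  parent-rank {chain i} _ = chainParent-rank i
  parent-rank {block k p} pv≢v =
    subst₂ _<_ (sym (rank-block k p)) (sym (rank-block k (positionParent p)))
      (s≤s (+-monoʳ-< e (+-monoʳ-< (6 * toℕ k) (positionParent-increasing (pv≢v ∘ cong (block k))))))

  parent≢hub : ∀ {v} → v ≢ hub → parent v ≢ hub
  parent≢hub {hub} hub≢hub = ⊥-elim (hub≢hub refl)
  parent≢hub {chain i} _ = chainParent≢hub i
  parent≢hub {block k p} _ ()

  parent-injective : ∀ a b → parent (parent a) ≢ parent a → parent a ≡ parent b → a ≡ b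
  parent-injective hub _ nonroot _ = ⊥-elim (nonroot refl)
  parent-injective (chain i) hub _ pa≡hub = ⊥-elim (chainParent≢hub i pa≡hub)
  parent-injective (chain i) (chain j) _ pa≡pb = cong chain (chainParent-injective i j pa≡pb)
  parent-injective (chain i) (block k q) _ pa≡pb = ⊥-elim (positionParent≢stub q (chainParent-stub i pa≡pb))
  parent-injective (block k p) (chain j) _ pa≡pb = ⊥-elim (positionParent≢stub p (chainParent-stub j (sym pa≡pb)))
  parent-injective (block k p) (block k′ q) nonroot pa≡pb with block-injective pa≡pb
  ... | refl , pp≡pq = cong (block k) (begin
          p                                   ≡⟨ positionChild-parent (nonroot ∘ cong (block k)) ⟨
          positionChild (positionParent p)    ≡⟨ cong positionChild pp≡pq ⟩
          positionChild (positionParent q)    ≡⟨ positionChild-parent (nonroot ∘ cong (block k) ∘ subst (λ r → positionParent r ≡ r) (sym pp≡pq)) ⟩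
          q                                   ∎)
    where open ≡-Reasoning

  root-is-centre : ∀ {v} → v ≢ hub → parent v ≡ v → Σ[ k ∈ Fin (suc t) ] v ≡ block k centre
  root-is-centre {hub} hub≢hub _ = ⊥-elim (hub≢hub refl)
  root-is-centre {chain i} _ pv≡v = ⊥-elim (<-irrefl (cong rank (sym pv≡v)) (chainParent-rank i))
  root-is-centre {block k stub} _ ()
  root-is-centre {block k foot₁} _ ()
  root-is-centre {block k foot₂} _ ()
  root-is-centre {block k knee₁} _ ()
  root-is-centre {block k knee₂} _ ()
  root-is-centre {block k centre} _ _ = k , refl

  centre-children : ∀ {k} a → parent a ≡ block k centre → a ≢ block k centre →
                    a ≡ block k knee₁ ⊎ a ≡ block k knee₂ ⊎ a ≡ block k stub
  centre-children hub () _
  centre-children (chain i) pa≡r _ = contradiction (chainParent-stub i pa≡r) λ ()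
  centre-children (block _ stub) refl _ = inj₂ (inj₂ refl)
  centre-children (block _ foot₁) () _
  centre-children (block _ foot₂) () _
  centre-children (block _ knee₁) refl _ = inj₁ refl
  centre-children (block _ knee₂) refl _ = inj₂ (inj₁ refl)
  centre-children (block _ centre) refl a≢r = ⊥-elim (a≢r refl)

  leaf-centre-child : ∀ {k a} → parent a ≡ block k centre → a ≢ block k centre →
                      (∀ z → parent z ≡ a → z ≡ a) → a ≡ block k stub
  leaf-centre-child {k} {a} pa≡r a≢r a-leaf with centre-children a pa≡r a≢r
  ... | inj₁ refl = contradiction (a-leaf (block k foot₁) refl) λ ()
  ... | inj₂ (inj₁ refl) = contradiction (a-leaf (block k foot₂) refl) λ ()
  ... | inj₂ (inj₂ a≡stub) = a≡stub

  childAt : Position → Vertex → Vertex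
  childAt p (block k _) = block k p
  childAt _ _ = hub

  module _ {r : Vertex} (root : r ≢ hub × parent r ≡ r) where
    childAt-isChild : ∀ p → positionParent p ≡ centre → p ≢ centre → parent (childAt p r) ≡ r × childAt p r ≢ r
    childAt-isChild p pp≡centre p≢centre with root-is-centre (proj₁ root) (proj₂ root)
    ... | k , refl = cong (block k) pp≡centre , p≢centre ∘ proj₂ ∘ block-injective

    childAt-distinct : ∀ {p q} → p ≢ q → childAt p r ≢ childAt q r
    childAt-distinct p≢q with root-is-centre (proj₁ root) (proj₂ root)
    ... | k , refl = p≢q ∘ proj₂ ∘ block-injective

  spiderForest : SpiderForest rank hub parent
  spiderForest = record
    { parent-hub = refl
    ; parent≢hub = parent≢hub
    ; parent-increasing = parent-rank
    ; child₁ = childAt knee₁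
    ; child₂ = childAt knee₂
    ; child₃ = childAt stub
    ; child₁-isChild = λ root → childAt-isChild root knee₁ refl λ ()
    ; child₂-isChild = λ root → childAt-isChild root knee₂ refl λ ()
    ; child₃-isChild = λ root → childAt-isChild root stub refl λ ()
    ; child₁≢child₂ = λ root → childAt-distinct root λ ()
    ; child₁≢child₃ = λ root → childAt-distinct root λ ()
    ; child₂≢child₃ = λ root → childAt-distinct root λ ()
    ; root-children = λ { {a = a} root (pa≡r , a≢r) → root-children a root pa≡r a≢r }
    ; nonroot-child-unique = λ { {a = a} {b} pr≢r refl pb≡pa → parent-injective a b pr≢r (sym pb≡pa) }
    ; leaf-child-unique = λ root (pa≡r , a≢r) (pb≡r , b≢r) → leaf-children-equal root pa≡r a≢r pb≡r b≢r
    }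
    where
      root-children : ∀ a {r} → r ≢ hub × parent r ≡ r → parent a ≡ r → a ≢ r →
                      a ≡ childAt knee₁ r ⊎ a ≡ childAt knee₂ r ⊎ a ≡ childAt stub r
      root-children a (r≢hub , pr≡r) pa≡r a≢r with root-is-centre r≢hub pr≡r
      ... | k , refl = centre-children a pa≡r a≢r
      leaf-children-equal : ∀ {r a b} → r ≢ hub × parent r ≡ r → parent a ≡ r → a ≢ r → parent b ≡ r → b ≢ r →
                            (∀ z → parent z ≡ a → z ≡ a) → (∀ z → parent z ≡ b → z ≡ b) → a ≡ b
      leaf-children-equal (r≢hub , pr≡r) pa≡r a≢r pb≡r b≢r a-leaf b-leaf with root-is-centre r≢hub pr≡r
      ... | k , refl = trans (leaf-centre-child pa≡r a≢r a-leaf) (sym (leaf-centre-child pb≡r b≢r b-leaf))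

  forest : SpiderForest toℕ fzero (encode ∘ parent ∘ decode)
  forest = relabel toℕ encode decode decode-encode encode-decode (λ _ → refl) spiderForest

  weight : Vertex → ℕ
  weight hub = N
  weight (chain _) = 1
  weight (block _ p) = positionWeight p

  nonroot-weight : ∀ v → parent v ≢ v → 1 ≤ weight v
  nonroot-weight hub hub≢hub = ⊥-elim (hub≢hub refl)
  nonroot-weight (chain _) _ = ≤-refl
  nonroot-weight (block _ stub) _ = ≤-refl
  nonroot-weight (block _ foot₁) _ = ≤-refl
  nonroot-weight (block _ foot₂) _ = ≤-refl
  nonroot-weight (block _ knee₁) _ = ≤-refl
  nonroot-weight (block _ knee₂) _ = ≤-refl
  nonroot-weight (block _ centre) centre≢centre = ⊥-elim (centre≢centre refl)

  total-weight : ∑ (weight ∘ decode) ≡ N + (e * 1 + suc t * 5)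
  total-weight = cong (N +_) (begin
    ∑ (weight ∘ decode ∘ fsuc)                                      ≡⟨ ∑-++ e _ ⟩
    ∑ (λ i → weight (decode (fsuc (i ↑ˡ (suc t * 6)))))
      + ∑ (λ b → weight (decode (fsuc (e ↑ʳ b))))                   ≡⟨ cong₂ _+_ (∑-cong (cong weight ∘ decode-chain))
                                                                                 (∑-combine (suc t) {6} (λ b → weight (decode (fsuc (e ↑ʳ b))))) ⟩
    ∑ {e} (λ _ → 1)
      + ∑ {suc t} (λ k → ∑ {6} (λ l → weight (decode (fsuc (e ↑ʳ combine k l))))) ≡⟨ cong₂ _+_ (∑-const e 1)
                                                                       (∑-cong λ k → ∑-cong λ l → cong weight (decode-block k l)) ⟩
    e * 1 + ∑ {suc t} (λ k → ∑ {6} (positionWeight ∘ position))        ≡⟨ cong (e * 1 +_) (∑-const (suc t) 5) ⟩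
    e * 1 + suc t * 5                                               ∎)
    where open ≡-Reasoning

  satStar-bound : SatStarC4≤ N (N + (e * 1 + suc t * 5))
  satStar-bound = HubJoin.G forest , HubJoin.G-simple forest , hubJoin-saturated forest ,
    ≤-trans (hubJoin-edgeCount forest refl (weight ∘ decode) ≤-refl nonroot) (≤-reflexive total-weight)
    where
      nonroot : ∀ {w} → encode (parent (decode w)) ≢ w → 1 ≤ weight (decode w)
      nonroot {w} pw≢w = nonroot-weight (decode w) (λ pdw≡dw → pw≢w (trans (cong encode pdw≡dw) (encode-decode w)))

spider-edges-identity : ∀ e t → 6 * (suc (e + suc t * 6) + (e * 1 + suc t * 5)) + 5 ≡ 11 * suc (e + suc t * 6) + e
spider-edges-identity = solve-∀

spider-edges-bound : ∀ e t → e ≤ 5 → 6 * (suc (e + suc t * 6) + (e * 1 + suc t * 5)) ≤ 11 * suc (e + suc t * 6)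
spider-edges-bound e t e≤5 = +-cancelʳ-≤ 5 _ _ (begin
  6 * (suc (e + suc t * 6) + (e * 1 + suc t * 5)) + 5   ≡⟨ spider-edges-identity e t ⟩
  11 * suc (e + suc t * 6) + e                          ≤⟨ +-monoʳ-≤ (11 * suc (e + suc t * 6)) e≤5 ⟩
  11 * suc (e + suc t * 6) + 5                          ∎)
  where open ≤-Reasoning

six-decomposition : ∀ m → 6 ≤ m → Σ[ e ∈ ℕ ] Σ[ t ∈ ℕ ] e ≤ 5 × m ≡ e + suc t * 6
six-decomposition m 6≤m with m / 6 | m≡m%n+[m/n]*n m 6 | /-monoˡ-≤ 6 6≤m
... | suc t | m≡e+[t+1]*6 | _ = m % 6 , t , s≤s⁻¹ (m%n<n m 6) , m≡e+[t+1]*6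

theorem5 : Σ ℕ λ K → ∀ (n : ℕ) → 7 ≤ n →
    Σ ℕ λ m → SatStarC4≤ n m × 6 * m ≤ 11 * n + 6 * K
theorem5 = 0 , bound
  where
    bound : ∀ n → 7 ≤ n → Σ ℕ λ m → SatStarC4≤ n m × 6 * m ≤ 11 * n + 6 * 0
    bound (suc n) (s≤s 6≤n) with six-decomposition n 6≤n
    ... | e , t , e≤5 , refl =
      m , Spiders.satStar-bound e t , subst (6 * m ≤_) (sym (+-identityʳ _)) (spider-edges-bound e t e≤5)
      where m = Spiders.N e t + (e * 1 + suc t * 5)
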